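{- Let $c>0$ be a constant and let $G$ be a multi-hypergraph on vertex set $V$ with $m$ edges such that $\Delta(G)<cm$. If $A$ and $B$ are disjoint subsets of $V$ with $d(A)\ge 2cm$ and $d(A)+2d(B)\ge 3cm$, then there is a partition of $A\cup B$ into two parts, each of which meets at least $cm$ edges.
   Context: Here a multi-hypergraph on a finite vertex set $V$ is a finite multiset of subsets of $V$ (edges); edges may have any sizes and may be repeated, and all edge counts are with multiplicity. For $X\subseteq V$, $d(X)$ denotes the number of edges meeting $X$ (i.e. having nonempty intersection with $X$), and $\Delta(G)$ is the maximum over vertices $v$ of the number of edges containing $v$.
   Formalization: The constant c ranges over the positive rationals. -}

module Defs where

open import Data.Nat using (ℕ; _⊔_)
open import Data.Fin using (Fin)
open import Data.Fin.Subset using (Subset; _∩_)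
open import Data.Fin.Subset.Properties using (nonempty?; _∈?_)
open import Data.List using (List; length; filter; foldr; allFin)
open import Data.Integer using (+_)
open import Data.Rational using (ℚ; _/_)

-- A multi-hypergraph on vertex set V = Fin n: a finite list (multiset) of edges,
-- each edge a subset of V.  Repetition in the list = multiplicity.
Hypergraph : ℕ → Set
Hypergraph n = List (Subset n)

numEdges : ∀ {n} → Hypergraph n → ℕ
numEdges G = length G

d : ∀ {n} → Hypergraph n → Subset n → ℕ
d G X = length (filter (λ e → nonempty? (e ∩ X)) G)

deg : ∀ {n} → Hypergraph n → Fin n → ℕ
deg G v = length (filter (λ e → v ∈? e) G)

Δ : ∀ {n} → Hypergraph n → ℕ
Δ {n} G = foldr (λ v acc → deg G v ⊔ acc) 0 (allFin n)

ℕ→ℚ : ℕ → ℚ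
ℕ→ℚ k = + k / 1

module Submission where

-- Enumerate A and let S ∪ {v} be its shortest initial segment meeting at least t = cm
-- edges, so d(S) < t, d({v}) ≤ Δ < t, and the rest T of A follows v.  Then S ∪ {v}
-- meets at least t edges, and so do {v} ∪ T and S ∪ T because d(A) ≥ 2t and d is
-- subadditive; each can be paired with the remaining piece of A together with B.  If
-- all three of T ∪ B, S ∪ B and {v} ∪ B meet fewer than t edges, double counting (an
-- edge meeting A meets one of them, an edge meeting B meets all three) gives
-- d(A) + 2d(B) < 3t, a contradiction.

open import Defs
open import Data.Nat using (ℕ)
open import Data.Fin.Subset using (Subset; _∩_; _∪_; ⊥)
open import Data.Rational using (ℚ; 0ℚ; _<_; _≤_; _*_; _+_)
open import Data.Product using (Σ; _×_)
open import Relation.Binary.PropositionalEquality using (_≡_)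

open import Level using (Level)
open import Function using (_∘_)
open import Function.Bundles using (Equivalence)
open import Data.Empty using (⊥-elim)
open import Data.Product using (∃-syntax; _,_; proj₁; proj₂)
open import Data.Sum using (_⊎_; inj₁; inj₂; [_,_])
import Data.Sum as Sum
open import Relation.Nullary using (Dec; yes; no; ¬_; contradiction)
open import Relation.Unary using (Pred; Decidable)
open import Relation.Binary.Definitions using (tri<; tri≈; tri>)
open import Relation.Binary.PropositionalEquality
  using (refl; sym; trans; cong; cong₂; subst; subst₂; module ≡-Reasoning)

open import Data.Nat using (zero; suc; z≤n; s≤s)
import Data.Nat as ℕ
import Data.Nat.Properties as ℕₚ
open import Data.Nat.ListAction using (sum)
open import Data.Nat.Coprimality using (1-coprimeTo) renaming (sym to Coprime-sym)
open import Algebra.Properties.CommutativeSemigroup ℕₚ.+-commutativeSemigroup using (interchange)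
import Data.Integer as ℤ
import Data.Integer.Properties as ℤₚ
open import Data.Rational using (mkℚ; 1ℚ; *≤*)
import Data.Rational.Properties as ℚₚ

open import Data.List using ([]; _∷_; map; filter; length; foldr)
import Data.List.Membership.Propositional as List
open import Data.List.Membership.Propositional.Properties using (∈-allFin)
open import Data.List.Relation.Unary.Any using (here; there)
open import Data.Vec using ([]; _∷_; here; there)
open import Data.Fin using (Fin; zero; suc; toℕ; fromℕ<)
open import Data.Fin.Properties using (toℕ-injective; toℕ-fromℕ<; toℕ<n)
open import Data.Fin.Subset using (_∈_; _⊆_; ∁; ⊤; ⁅_⁆; Nonempty; Empty; inside)
open import Data.Fin.Subset.Properties

module _ {ℓ : Level} where

  indicator : {P : Set ℓ} → Dec P → ℕ
  indicator (yes _) = 1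
  indicator (no _)  = 0

  indicator-mono : {P Q : Set ℓ} → (P → Q) → (p : Dec P) (q : Dec Q) → indicator p ℕ.≤ indicator q
  indicator-mono P⇒Q (no _)  _       = z≤n
  indicator-mono P⇒Q (yes _) (yes _) = s≤s z≤n
  indicator-mono P⇒Q (yes p) (no ¬q) = contradiction (P⇒Q p) ¬q

  indicator-⊎ : {P Q R : Set ℓ} → (P → Q ⊎ R) →
                (p : Dec P) (q : Dec Q) (r : Dec R) → indicator p ℕ.≤ indicator q ℕ.+ indicator r
  indicator-⊎ P⇒Q⊎R (no _)  _       _       = z≤n
  indicator-⊎ P⇒Q⊎R (yes _) (yes _) _       = s≤s z≤n
  indicator-⊎ P⇒Q⊎R (yes _) (no _)  (yes _) = s≤s z≤n
  indicator-⊎ P⇒Q⊎R (yes p) (no ¬q) (no ¬r) = ⊥-elim ([ ¬q , ¬r ] (P⇒Q⊎R p))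

  indicator-cover₃ : {P W Q₁ Q₂ Q₃ : Set ℓ} → (P → Q₁ ⊎ Q₂ ⊎ Q₃) → (W → Q₁ × Q₂ × Q₃) →
                     (p : Dec P) (w : Dec W) (q₁ : Dec Q₁) (q₂ : Dec Q₂) (q₃ : Dec Q₃) →
                     indicator p ℕ.+ (indicator w ℕ.+ indicator w) ℕ.≤
                       (indicator q₁ ℕ.+ indicator q₂) ℕ.+ indicator q₃
  indicator-cover₃ _ _ (yes _) (yes _) (yes _) (yes _) (yes _) = ℕₚ.≤-refl
  indicator-cover₃ _ _ (no _)  (yes _) (yes _) (yes _) (yes _) = s≤s (s≤s z≤n)
  indicator-cover₃ _ W⇒Q _ (yes w) (no ¬q) _ _ = contradiction (proj₁ (W⇒Q w)) ¬q
  indicator-cover₃ _ W⇒Q _ (yes w) _ (no ¬q) _ = contradiction (proj₁ (proj₂ (W⇒Q w))) ¬q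
  indicator-cover₃ _ W⇒Q _ (yes w) _ _ (no ¬q) = contradiction (proj₂ (proj₂ (W⇒Q w))) ¬q
  indicator-cover₃ _ _ (no _)  (no _) _ _ _ = z≤n
  indicator-cover₃ _ _ (yes _) (no _) (yes _) _ _ = s≤s z≤n
  indicator-cover₃ _ _ (yes _) (no _) (no _) (yes _) _ = s≤s z≤n
  indicator-cover₃ _ _ (yes _) (no _) (no _) (no _) (yes _) = s≤s z≤n
  indicator-cover₃ P⇒Q _ (yes p) (no _) (no ¬q₁) (no ¬q₂) (no ¬q₃) = ⊥-elim ([ ¬q₁ , [ ¬q₂ , ¬q₃ ] ] (P⇒Q p))

module _ {a : Level} {A : Set a} where

  sum-map-mono : {f g : A → ℕ} → (∀ x → f x ℕ.≤ g x) → ∀ xs → sum (map f xs) ℕ.≤ sum (map g xs)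
  sum-map-mono f≤g []       = z≤n
  sum-map-mono f≤g (x ∷ xs) = ℕₚ.+-mono-≤ (f≤g x) (sum-map-mono f≤g xs)

  sum-map-+ : (f g : A → ℕ) → ∀ xs →
              sum (map (λ x → f x ℕ.+ g x) xs) ≡ sum (map f xs) ℕ.+ sum (map g xs)
  sum-map-+ f g []       = refl
  sum-map-+ f g (x ∷ xs) = begin
    (f x ℕ.+ g x) ℕ.+ sum (map (λ y → f y ℕ.+ g y) xs)     ≡⟨ cong ((f x ℕ.+ g x) ℕ.+_) (sum-map-+ f g xs) ⟩
    (f x ℕ.+ g x) ℕ.+ (sum (map f xs) ℕ.+ sum (map g xs))  ≡⟨ interchange (f x) (g x) _ _ ⟩
    (f x ℕ.+ sum (map f xs)) ℕ.+ (g x ℕ.+ sum (map g xs))  ∎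
    where open ≡-Reasoning

module _ {a ℓ : Level} {A : Set a} where

  length-filter≡sum-indicator : {P : Pred A ℓ} (P? : Decidable P) →
                                ∀ xs → length (filter P? xs) ≡ sum (map (indicator ∘ P?) xs)
  length-filter≡sum-indicator P? []       = refl
  length-filter≡sum-indicator P? (x ∷ xs) with P? x
  ... | yes _ = cong suc (length-filter≡sum-indicator P? xs)
  ... | no _  = length-filter≡sum-indicator P? xs

  count-mono : {P Q : Pred A ℓ} (P? : Decidable P) (Q? : Decidable Q) →
               (∀ {x} → P x → Q x) → ∀ xs → length (filter P? xs) ℕ.≤ length (filter Q? xs)
  count-mono P? Q? P⇒Q xs = begin
    length (filter P? xs)         ≡⟨ length-filter≡sum-indicator P? xs ⟩
    sum (map (indicator ∘ P?) xs) ≤⟨ sum-map-mono (λ x → indicator-mono P⇒Q (P? x) (Q? x)) xs ⟩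
    sum (map (indicator ∘ Q?) xs) ≡⟨ length-filter≡sum-indicator Q? xs ⟨
    length (filter Q? xs)         ∎
    where open ℕₚ.≤-Reasoning

  count-⊎ : {P Q R : Pred A ℓ} (P? : Decidable P) (Q? : Decidable Q) (R? : Decidable R) →
            (∀ {x} → P x → Q x ⊎ R x) → ∀ xs →
            length (filter P? xs) ℕ.≤ length (filter Q? xs) ℕ.+ length (filter R? xs)
  count-⊎ P? Q? R? P⇒Q⊎R xs = begin
    length (filter P? xs)
      ≡⟨ length-filter≡sum-indicator P? xs ⟩
    sum (map (indicator ∘ P?) xs)
      ≤⟨ sum-map-mono (λ x → indicator-⊎ P⇒Q⊎R (P? x) (Q? x) (R? x)) xs ⟩
    sum (map (λ x → indicator (Q? x) ℕ.+ indicator (R? x)) xs)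
      ≡⟨ sum-map-+ (indicator ∘ Q?) (indicator ∘ R?) xs ⟩
    sum (map (indicator ∘ Q?) xs) ℕ.+ sum (map (indicator ∘ R?) xs)
      ≡⟨ cong₂ ℕ._+_ (length-filter≡sum-indicator Q? xs) (length-filter≡sum-indicator R? xs) ⟨
    length (filter Q? xs) ℕ.+ length (filter R? xs)
      ∎
    where open ℕₚ.≤-Reasoning

  count-cover₃ : {P W Q₁ Q₂ Q₃ : Pred A ℓ} (P? : Decidable P) (W? : Decidable W)
                 (Q₁? : Decidable Q₁) (Q₂? : Decidable Q₂) (Q₃? : Decidable Q₃) →
                 (∀ {x} → P x → Q₁ x ⊎ Q₂ x ⊎ Q₃ x) → (∀ {x} → W x → Q₁ x × Q₂ x × Q₃ x) → ∀ xs →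
                 length (filter P? xs) ℕ.+ (length (filter W? xs) ℕ.+ length (filter W? xs)) ℕ.≤
                   (length (filter Q₁? xs) ℕ.+ length (filter Q₂? xs)) ℕ.+ length (filter Q₃? xs)
  count-cover₃ P? W? Q₁? Q₂? Q₃? P⇒Q W⇒Q xs
    rewrite length-filter≡sum-indicator P? xs | length-filter≡sum-indicator W? xs
          | length-filter≡sum-indicator Q₁? xs | length-filter≡sum-indicator Q₂? xs
          | length-filter≡sum-indicator Q₃? xs = begin
    sum (map (ι P?) xs) ℕ.+ (sum (map (ι W?) xs) ℕ.+ sum (map (ι W?) xs))
      ≡⟨ cong (sum (map (ι P?) xs) ℕ.+_) (sum-map-+ (ι W?) (ι W?) xs) ⟨
    sum (map (ι P?) xs) ℕ.+ sum (map (λ x → ι W? x ℕ.+ ι W? x) xs)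
      ≡⟨ sum-map-+ (ι P?) (λ x → ι W? x ℕ.+ ι W? x) xs ⟨
    sum (map (λ x → ι P? x ℕ.+ (ι W? x ℕ.+ ι W? x)) xs)
      ≤⟨ sum-map-mono (λ x → indicator-cover₃ P⇒Q W⇒Q (P? x) (W? x) (Q₁? x) (Q₂? x) (Q₃? x)) xs ⟩
    sum (map (λ x → (ι Q₁? x ℕ.+ ι Q₂? x) ℕ.+ ι Q₃? x) xs)
      ≡⟨ sum-map-+ (λ x → ι Q₁? x ℕ.+ ι Q₂? x) (ι Q₃?) xs ⟩
    sum (map (λ x → ι Q₁? x ℕ.+ ι Q₂? x) xs) ℕ.+ sum (map (ι Q₃?) xs)
      ≡⟨ cong (ℕ._+ sum (map (ι Q₃?) xs)) (sum-map-+ (ι Q₁?) (ι Q₂?) xs) ⟩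
    (sum (map (ι Q₁?) xs) ℕ.+ sum (map (ι Q₂?) xs)) ℕ.+ sum (map (ι Q₃?) xs)
      ∎
    where
    open ℕₚ.≤-Reasoning
    ι : {S : Pred A ℓ} → Decidable S → A → ℕ
    ι S? = indicator ∘ S?

module _ {n : ℕ} where

  meets-mono : ∀ {e X Y : Subset n} → X ⊆ Y → Nonempty (e ∩ X) → Nonempty (e ∩ Y)
  meets-mono {e} {X} X⊆Y (x , x∈e∩X) with x∈p∩q⁻ e X x∈e∩X
  ... | x∈e , x∈X = x , x∈p∩q⁺ (x∈e , X⊆Y x∈X)

  meets-∪⁻ : ∀ {e X Y : Subset n} → Nonempty (e ∩ (X ∪ Y)) → Nonempty (e ∩ X) ⊎ Nonempty (e ∩ Y)
  meets-∪⁻ {e} {X} {Y} (x , x∈e∩X∪Y) with x∈p∩q⁻ e (X ∪ Y) x∈e∩X∪Y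
  ... | x∈e , x∈X∪Y = Sum.map (λ x∈X → x , x∈p∩q⁺ (x∈e , x∈X)) (λ x∈Y → x , x∈p∩q⁺ (x∈e , x∈Y))
                              (x∈p∪q⁻ X Y x∈X∪Y)

  p∩∁q∪p∩q≡p : ∀ (p q : Subset n) → (p ∩ ∁ q) ∪ (p ∩ q) ≡ p
  p∩∁q∪p∩q≡p p q = begin
    (p ∩ ∁ q) ∪ (p ∩ q) ≡⟨ ∩-distribˡ-∪ p (∁ q) q ⟨
    p ∩ (∁ q ∪ q)       ≡⟨ cong (p ∩_) (∪-inverseˡ q) ⟩
    p ∩ ⊤               ≡⟨ ∩-identityʳ p ⟩
    p                   ∎
    where open ≡-Reasoning

  split-off-∪ : ∀ (A B M : Subset n) → (A ∩ ∁ M) ∪ ((A ∩ M) ∪ B) ≡ A ∪ B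
  split-off-∪ A B M = trans (sym (∪-assoc (A ∩ ∁ M) (A ∩ M) B)) (cong (_∪ B) (p∩∁q∪p∩q≡p A M))

  split-off-disjoint : ∀ (A B M : Subset n) → A ∩ B ≡ ⊥ → (A ∩ ∁ M) ∩ ((A ∩ M) ∪ B) ≡ ⊥
  split-off-disjoint A B M A∩B≡⊥ = Empty-unique empty
    where
    empty : Empty ((A ∩ ∁ M) ∩ ((A ∩ M) ∪ B))
    empty (x , x∈P∩Q) with x∈p∩q⁻ (A ∩ ∁ M) _ x∈P∩Q
    ... | x∈A∩∁M , x∈Q with x∈p∩q⁻ A (∁ M) x∈A∩∁M | x∈p∪q⁻ (A ∩ M) B x∈Q
    ... | _   , x∈∁M | inj₁ x∈A∩M = x∈∁p⇒x∉p x∈∁M (proj₂ (x∈p∩q⁻ A M x∈A∩M))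
    ... | x∈A , _    | inj₂ x∈B   = ∉⊥ (subst (x ∈_) A∩B≡⊥ (x∈p∩q⁺ (x∈A , x∈B)))

below : ∀ {n} → ℕ → Subset n
below zero = ⊥
below {zero}  (suc i) = []
below {suc _} (suc i) = inside ∷ below i

x∈below⁺ : ∀ {n i} {x : Fin n} → toℕ x ℕ.< i → x ∈ below i
x∈below⁺ {i = suc i} {x = zero}  _         = here
x∈below⁺ {i = suc i} {x = suc x} (s≤s x<i) = there (x∈below⁺ x<i)

x∈below⁻ : ∀ {n i} {x : Fin n} → x ∈ below i → toℕ x ℕ.< i
x∈below⁻ {i = zero}              x∈⊥         = contradiction x∈⊥ ∉⊥
x∈below⁻ {i = suc i} {x = zero}  here        = s≤s z≤n
x∈below⁻ {i = suc i} {x = suc x} (there x∈) = s≤s (x∈below⁻ x∈)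

below-⁅⁆-cover : ∀ {n i} (i<n : i ℕ.< n) (x : Fin n) →
                 x ∈ below i ⊎ x ∈ ⁅ fromℕ< i<n ⁆ ⊎ x ∈ ∁ (below (suc i))
below-⁅⁆-cover {i = i} i<n x with ℕₚ.<-cmp (toℕ x) i
... | tri< x<i _ _ = inj₁ (x∈below⁺ x<i)
... | tri≈ _ x≡i _ = inj₂ (inj₁ (Equivalence.from x∈⁅y⁆⇔x≡y (toℕ-injective (trans x≡i (sym (toℕ-fromℕ< i<n))))))
... | tri> _ _ i<x = inj₂ (inj₂ (x∉p⇒x∈∁p (ℕₚ.<⇒≱ i<x ∘ ℕₚ.m<1+n⇒m≤n ∘ x∈below⁻)))

module _ {n : ℕ} (G : Hypergraph n) where

  d-⊥ : d G ⊥ ≡ 0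
  d-⊥ = go G
    where
    go : (H : Hypergraph n) → d H ⊥ ≡ 0
    go []      = refl
    go (e ∷ H) with nonempty? (e ∩ ⊥)
    ... | yes (_ , x∈e∩⊥) = contradiction (p∩q⊆q e ⊥ x∈e∩⊥) ∉⊥
    ... | no _            = go H

  d-mono : ∀ {X Y : Subset n} → X ⊆ Y → d G X ℕ.≤ d G Y
  d-mono X⊆Y = count-mono _ _ (meets-mono X⊆Y) G

  d-subadditive : ∀ {X Y Z : Subset n} → X ⊆ Y ∪ Z → d G X ℕ.≤ d G Y ℕ.+ d G Z
  d-subadditive X⊆Y∪Z = count-⊎ _ _ _ (meets-∪⁻ ∘ meets-mono X⊆Y∪Z) G

  d-cover₃ : ∀ {X Y₁ Y₂ Y₃ W : Subset n} → X ⊆ Y₁ ∪ Y₂ ∪ Y₃ →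
             d G X ℕ.+ (d G W ℕ.+ d G W) ℕ.≤
               (d G (Y₁ ∪ W) ℕ.+ d G (Y₂ ∪ W)) ℕ.+ d G (Y₃ ∪ W)
  d-cover₃ {Y₁ = Y₁} {Y₂} {Y₃} {W} X⊆Y = count-cover₃ _ _ _ _ _ meets-Yᵢ∪W meets-all G
    where
    meets-Yᵢ∪W : ∀ {e} → Nonempty (e ∩ _) →
                 Nonempty (e ∩ (Y₁ ∪ W)) ⊎ Nonempty (e ∩ (Y₂ ∪ W)) ⊎ Nonempty (e ∩ (Y₃ ∪ W))
    meets-Yᵢ∪W = Sum.map (meets-mono (p⊆p∪q W)) (Sum.map (meets-mono (p⊆p∪q W)) (meets-mono (p⊆p∪q W)) ∘ meets-∪⁻)
               ∘ meets-∪⁻ ∘ meets-mono X⊆Y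
    meets-all : ∀ {e} → Nonempty (e ∩ W) →
                Nonempty (e ∩ (Y₁ ∪ W)) × Nonempty (e ∩ (Y₂ ∪ W)) × Nonempty (e ∩ (Y₃ ∪ W))
    meets-all m = meets-mono (q⊆p∪q Y₁ W) m , meets-mono (q⊆p∪q Y₂ W) m , meets-mono (q⊆p∪q Y₃ W) m

  d≤deg : ∀ {X : Subset n} (v : Fin n) → X ⊆ ⁅ v ⁆ → d G X ℕ.≤ deg G v
  d≤deg {X} v X⊆v = count-mono _ (v ∈?_) contains-v G
    where
    contains-v : ∀ {e} → Nonempty (e ∩ X) → v ∈ e
    contains-v {e} (x , x∈e∩X) with x∈p∩q⁻ e X x∈e∩X
    ... | x∈e , x∈X = subst (_∈ e) (x∈⁅y⁆⇒x≡y v (X⊆v x∈X)) x∈e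

  deg≤Δ : (v : Fin n) → deg G v ℕ.≤ Δ G
  deg≤Δ v = ≤-foldr-⊔ (∈-allFin v)
    where
    ≤-foldr-⊔ : ∀ {us} → v List.∈ us → deg G v ℕ.≤ foldr (λ u acc → deg G u ℕ.⊔ acc) 0 us
    ≤-foldr-⊔ {u ∷ us} (here refl) = ℕₚ.m≤m⊔n (deg G v) _
    ≤-foldr-⊔ {u ∷ us} (there v∈us) = ℕₚ.m≤n⇒m≤o⊔n (deg G u) (≤-foldr-⊔ v∈us)

ℕ→ℚ≡mkℚ : ∀ k → ℕ→ℚ k ≡ mkℚ (ℤ.+ k) 0 (Coprime-sym (1-coprimeTo k))
ℕ→ℚ≡mkℚ k = ℚₚ.normalize-coprime (Coprime-sym (1-coprimeTo k))

ℕ→ℚ-mono-≤ : ∀ {a b} → a ℕ.≤ b → ℕ→ℚ a ≤ ℕ→ℚ b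
ℕ→ℚ-mono-≤ {a} {b} a≤b rewrite ℕ→ℚ≡mkℚ a | ℕ→ℚ≡mkℚ b =
  *≤* (subst₂ ℤ._≤_ (sym (ℤₚ.*-identityʳ (ℤ.+ a))) (sym (ℤₚ.*-identityʳ (ℤ.+ b))) (ℤ.+≤+ a≤b))

ℕ→ℚ-homo-+ : ∀ a b → ℕ→ℚ (a ℕ.+ b) ≡ ℕ→ℚ a + ℕ→ℚ b
ℕ→ℚ-homo-+ a b rewrite ℕ→ℚ≡mkℚ a | ℕ→ℚ≡mkℚ b | ℤₚ.*-identityʳ (ℤ.+ a) | ℤₚ.*-identityʳ (ℤ.+ b) = refl

ℕ→ℚ-<-+ : ∀ {a} x y {r s : ℚ} → a ℕ.≤ x ℕ.+ y → ℕ→ℚ x < r → ℕ→ℚ y < s → ℕ→ℚ a < r + s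
ℕ→ℚ-<-+ {a} x y {r} {s} a≤x+y x<r y<s = begin-strict
  ℕ→ℚ a             ≤⟨ ℕ→ℚ-mono-≤ a≤x+y ⟩
  ℕ→ℚ (x ℕ.+ y)     ≡⟨ ℕ→ℚ-homo-+ x y ⟩
  ℕ→ℚ x + ℕ→ℚ y     <⟨ ℚₚ.+-mono-< x<r y<s ⟩
  r + s             ∎
  where open ℚₚ.≤-Reasoning

<⇒≱ : ∀ {p q : ℚ} → p < q → ¬ (q ≤ p)
<⇒≱ p<q q≤p = ℚₚ.<-irrefl refl (ℚₚ.<-≤-trans p<q q≤p)

-- ℕ→ℚ 2 computes to 1ℚ + 1ℚ.
2*p≡p+p : ∀ p → ℕ→ℚ 2 * p ≡ p + p
2*p≡p+p p = trans (ℚₚ.*-distribʳ-+ p 1ℚ 1ℚ) (cong₂ _+_ (ℚₚ.*-identityˡ p) (ℚₚ.*-identityˡ p))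

3*p≡p+p+p : ∀ p → ℕ→ℚ 3 * p ≡ (p + p) + p
3*p≡p+p+p p = trans (ℚₚ.*-distribʳ-+ p (ℕ→ℚ 2) 1ℚ) (cong₂ _+_ (2*p≡p+p p) (ℚₚ.*-identityˡ p))

crossing : ∀ {ℓ} {P : Pred ℕ ℓ} → Decidable P → ¬ P 0 → ∀ {k} → P k →
           ∃[ i ] i ℕ.< k × ¬ P i × P (suc i)
crossing P? ¬P0 {zero}  P0 = contradiction P0 ¬P0
crossing P? ¬P0 {suc k} Pk+1 with P? k
... | no ¬Pk = k , ℕₚ.n<1+n k , ¬Pk , Pk+1
... | yes Pk with crossing P? ¬P0 Pk
...   | i , i<k , ¬Pi , Pi+1 = i , ℕₚ.m<n⇒m<1+n i<k , ¬Pi , Pi+1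

module _ {n : ℕ} (G : Hypergraph n) {A B : Subset n} {t : ℚ} (A∩B≡⊥ : A ∩ B ≡ ⊥)
         (Δ<t : ℕ→ℚ (Δ G) < t) (t+t≤dA : t + t ≤ ℕ→ℚ (d G A))
         (t+t+t≤dA+2dB : (t + t) + t ≤ ℕ→ℚ (d G A ℕ.+ (d G B ℕ.+ d G B))) where

  open import Algebra.Lattice.Properties.BooleanAlgebra (∪-∩-booleanAlgebra n) using (¬-involutive)

  GoodPartition : Set
  GoodPartition = Σ (Subset n) λ P → Σ (Subset n) λ Q →
    (P ∪ Q ≡ A ∪ B) × (P ∩ Q ≡ ⊥) × (t ≤ ℕ→ℚ (d G P)) × (t ≤ ℕ→ℚ (d G Q))

  split-off : (M : Subset n) → t ≤ ℕ→ℚ (d G (A ∩ ∁ M)) → t ≤ ℕ→ℚ (d G ((A ∩ M) ∪ B)) → GoodPartition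
  split-off M P-large Q-large =
    A ∩ ∁ M , (A ∩ M) ∪ B , split-off-∪ A B M , split-off-disjoint A B M A∩B≡⊥ , P-large , Q-large

  complement-large : (M : Subset n) → ℕ→ℚ (d G (A ∩ M)) < t → t ≤ ℕ→ℚ (d G (A ∩ ∁ M))
  complement-large M A∩M-small = ℚₚ.≮⇒≥ λ A∩∁M-small → <⇒≱ (dA<t+t A∩∁M-small) t+t≤dA
    where
    dA<t+t : ℕ→ℚ (d G (A ∩ ∁ M)) < t → ℕ→ℚ (d G A) < t + t
    dA<t+t A∩∁M-small = ℕ→ℚ-<-+ (d G (A ∩ ∁ M)) (d G (A ∩ M))
      (d-subadditive G (⊆-reflexive (sym (p∩∁q∪p∩q≡p A M)))) A∩∁M-small A∩M-small

  partition-from-masks : (M₁ M₂ M₃ : Subset n) → (∀ x → x ∈ M₁ ⊎ x ∈ M₂ ⊎ x ∈ M₃) →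
                         t ≤ ℕ→ℚ (d G (A ∩ ∁ M₁)) → t ≤ ℕ→ℚ (d G (A ∩ ∁ M₂)) → t ≤ ℕ→ℚ (d G (A ∩ ∁ M₃)) →
                         GoodPartition
  partition-from-masks M₁ M₂ M₃ cover P₁-large P₂-large P₃-large =
    choose (t ℚₚ.≤? ℕ→ℚ (d G Q₁)) (t ℚₚ.≤? ℕ→ℚ (d G Q₂)) (t ℚₚ.≤? ℕ→ℚ (d G Q₃))
    where
    Q₁ Q₂ Q₃ : Subset n
    Q₁ = (A ∩ M₁) ∪ B
    Q₂ = (A ∩ M₂) ∪ B
    Q₃ = (A ∩ M₃) ∪ B
    A⊆⋃A∩Mᵢ : A ⊆ (A ∩ M₁) ∪ (A ∩ M₂) ∪ (A ∩ M₃)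
    A⊆⋃A∩Mᵢ {x} x∈A = x∈p∪q⁺ (Sum.map in-A∩ (x∈p∪q⁺ ∘ Sum.map in-A∩ in-A∩) (cover x))
      where
      in-A∩ : ∀ {M} → x ∈ M → x ∈ A ∩ M
      in-A∩ x∈M = x∈p∩q⁺ (x∈A , x∈M)
    choose : Dec (t ≤ ℕ→ℚ (d G Q₁)) → Dec (t ≤ ℕ→ℚ (d G Q₂)) → Dec (t ≤ ℕ→ℚ (d G Q₃)) → GoodPartition
    choose (yes Q₁-large) _              _              = split-off M₁ P₁-large Q₁-large
    choose (no _)         (yes Q₂-large) _              = split-off M₂ P₂-large Q₂-large
    choose (no _)         (no _)         (yes Q₃-large) = split-off M₃ P₃-large Q₃-large
    choose (no Q₁-small)  (no Q₂-small)  (no Q₃-small)  = contradiction t+t+t≤dA+2dB (<⇒≱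
      (ℕ→ℚ-<-+ (d G Q₁ ℕ.+ d G Q₂) (d G Q₃) (d-cover₃ G A⊆⋃A∩Mᵢ)
        (ℕ→ℚ-<-+ (d G Q₁) (d G Q₂) ℕₚ.≤-refl (ℚₚ.≰⇒> Q₁-small) (ℚₚ.≰⇒> Q₂-small)) (ℚₚ.≰⇒> Q₃-small)))

  good-partition : GoodPartition
  good-partition = partition-at (crossing (λ i → t ℚₚ.≤? ℕ→ℚ (d G (A ∩ below i))) none-below-0 all-below-n)
    where
    0<t : 0ℚ < t
    0<t = ℚₚ.≤-<-trans (ℕ→ℚ-mono-≤ (z≤n {Δ G})) Δ<t
    none-below-0 : ¬ (t ≤ ℕ→ℚ (d G (A ∩ below 0)))
    none-below-0 = <⇒≱ (subst (λ k → ℕ→ℚ k < t) (sym (trans (cong (d G) (∩-zeroʳ A)) (d-⊥ G))) 0<t)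
    all-below-n : t ≤ ℕ→ℚ (d G (A ∩ below n))
    all-below-n = begin
      t                         ≡⟨ ℚₚ.+-identityʳ t ⟨
      t + 0ℚ                    ≤⟨ ℚₚ.+-monoʳ-≤ t (ℚₚ.<⇒≤ 0<t) ⟩
      t + t                     ≤⟨ t+t≤dA ⟩
      ℕ→ℚ (d G A)               ≤⟨ ℕ→ℚ-mono-≤ (d-mono G (λ {x} x∈A → x∈p∩q⁺ (x∈A , x∈below⁺ (toℕ<n x)))) ⟩
      ℕ→ℚ (d G (A ∩ below n))   ∎
      where open ℚₚ.≤-Reasoning
    vertex-small : ∀ v → d G (A ∩ ⁅ v ⁆) ℕ.≤ Δ G
    vertex-small v = ℕₚ.≤-trans (d≤deg G v (p∩q⊆q A ⁅ v ⁆)) (deg≤Δ G v)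
    partition-at : ∃[ i ] i ℕ.< n × ¬ (t ≤ ℕ→ℚ (d G (A ∩ below i))) × t ≤ ℕ→ℚ (d G (A ∩ below (suc i))) →
                   GoodPartition
    partition-at (i , i<n , ¬large-below-i , large-below-i+1) =
      partition-from-masks (below i) ⁅ fromℕ< i<n ⁆ (∁ (below (suc i))) (below-⁅⁆-cover i<n)
        (complement-large (below i) (ℚₚ.≰⇒> ¬large-below-i))
        (complement-large ⁅ fromℕ< i<n ⁆ (ℚₚ.≤-<-trans (ℕ→ℚ-mono-≤ (vertex-small (fromℕ< i<n))) Δ<t))
        (subst (λ M → t ≤ ℕ→ℚ (d G (A ∩ M))) (sym (¬-involutive (below (suc i)))) large-below-i+1)

lemma2 : (c : ℚ) → 0ℚ < c →
         {n : ℕ} (G : Hypergraph n) →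
         ℕ→ℚ (Δ G) < c * ℕ→ℚ (numEdges G) →
         (A B : Subset n) → A ∩ B ≡ ⊥ →
         ℕ→ℚ 2 * c * ℕ→ℚ (numEdges G) ≤ ℕ→ℚ (d G A) →
         ℕ→ℚ 3 * c * ℕ→ℚ (numEdges G) ≤ ℕ→ℚ (d G A) + ℕ→ℚ 2 * ℕ→ℚ (d G B) →
         Σ (Subset n) λ P → Σ (Subset n) λ Q →
           (P ∪ Q ≡ A ∪ B) × (P ∩ Q ≡ ⊥) ×
           (c * ℕ→ℚ (numEdges G) ≤ ℕ→ℚ (d G P)) ×
           (c * ℕ→ℚ (numEdges G) ≤ ℕ→ℚ (d G Q))
lemma2 c _ G Δ<cm A B A∩B≡⊥ 2cm≤dA 3cm≤dA+2dB =
  good-partition G A∩B≡⊥ Δ<cm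
    (subst (_≤ ℕ→ℚ (d G A)) (trans (ℚₚ.*-assoc (ℕ→ℚ 2) c m) (2*p≡p+p (c * m))) 2cm≤dA)
    (subst₂ _≤_ (trans (ℚₚ.*-assoc (ℕ→ℚ 3) c m) (3*p≡p+p+p (c * m))) (sym (ℕ→ℚ-a+2b (d G A) (d G B)))
            3cm≤dA+2dB)
  where
  m : ℚ
  m = ℕ→ℚ (numEdges G)
  ℕ→ℚ-a+2b : ∀ a b → ℕ→ℚ (a ℕ.+ (b ℕ.+ b)) ≡ ℕ→ℚ a + ℕ→ℚ 2 * ℕ→ℚ b
  ℕ→ℚ-a+2b a b = begin
    ℕ→ℚ (a ℕ.+ (b ℕ.+ b))        ≡⟨ ℕ→ℚ-homo-+ a (b ℕ.+ b) ⟩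
    ℕ→ℚ a + ℕ→ℚ (b ℕ.+ b)        ≡⟨ cong (ℕ→ℚ a +_) (ℕ→ℚ-homo-+ b b) ⟩
    ℕ→ℚ a + (ℕ→ℚ b + ℕ→ℚ b)      ≡⟨ cong (ℕ→ℚ a +_) (2*p≡p+p (ℕ→ℚ b)) ⟨
    ℕ→ℚ a + ℕ→ℚ 2 * ℕ→ℚ b        ∎
    where open ≡-Reasoning
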